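{- Let $k$ be an integer with $k\ge 80$ and let $r\in\{0,1,2,3,4\}$. Then $$\binom {5k+r}k<\frac{(5k+r)^{5k+r-\frac 12}}{k^k(4k+r)^{4k+r}}.$$ -}

module Defs where

open import Data.Nat using (ℕ; _+_; _*_; _^_; _<_)
open import Data.Nat.Combinatorics using (_C_)

-- The inequality  C(5k+r, k) < N^(N - 1/2) / (k^k * M^M),  with N = 5k+r, M = 4k+r,
-- cleared of the real exponent:  since all quantities are positive, it is
-- equivalent to  C * k^k * M^M * sqrt N < N^N, i.e. (after squaring)
--   (C * k^k * M^M)^2 * N < N^(2N).
BinomBound : ℕ → ℕ → Set
BinomBound k r =
  let N = 5 * k + r
      M = 4 * k + r
  in ((N C k) * (k ^ k) * (M ^ M)) ^ 2 * N < N ^ (2 * N)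

{-# OPTIONS --safe #-}
module Submission where

open import Defs
open import Data.Nat
open import Data.Nat.Properties
open import Data.Nat.Combinatorics using (_C_; nCk≡n!/k![n-k]!; k![n∸k]!∣n!)
open import Data.Nat.DivMod using (_/_; m/n*n≡m)
open import Data.Nat.Tactic.RingSolver using (solve-∀)
open import Data.Product using (_×_; _,_; proj₁; proj₂)
open import Relation.Binary.PropositionalEquality
open import Relation.Nullary.Decidable using (Dec; yes; no; from-yes)
open import Algebra.Properties.CommutativeSemigroup *-commutativeSemigroup
  using (xy∙z≈xz∙y; xy∙z≈y∙xz; x∙yz≈yx∙z; x∙yz≈xz∙y; interchange)

-- Let Φ(a, b) = C(a+b, a)² a^(2a+1) b^(2b+1) / (a+b)^(2(a+b)+1).  Squared and cleared of
-- denominators, the claim says Φ(k, M) < kM/N² for N = 5k + r and M = 4k + r.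
-- Since Φ(a+1, b) / Φ(a, b) = T(a) / T(a+b) with T(m) = (1 + 1/m)^(2m+1) decreasing, Φ increases
-- in both arguments; the correction Ψ = Φ (a+1)²(b+1)²(a+b)² / (a²b²(a+b+1)²) satisfies
-- Ψ(a+1, b) / Ψ(a, b) = X(a) / X(a+b) with X(m) = T(m) (m(m+2) / (m+1)²)² increasing, so Ψ
-- decreases.  Both tend to 1/2π, so Φ(k, M) ≤ Ψ(3000, 3000) < kM/N² once k ≥ 140; the cases
-- 80 ≤ k < 140 are settled by computation.  The monotonicity of T and X comes down, with
-- D = m(m+2) and D + 1 = (m+1)², to bounding (1 + 1/D)^(2m+1) from both sides by its binomial
-- expansion truncated after the cubic term.

-- A pair (a , b) stands for the fraction a / b.
infix 4 _≤ᵣ_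

_≤ᵣ_ : ℕ × ℕ → ℕ × ℕ → Set
(a , b) ≤ᵣ (c , d) = a * d ≤ c * b

≤ᵣ-refl : ∀ p → p ≤ᵣ p
≤ᵣ-refl (a , b) = ≤-refl

≤ᵣ-trans : ∀ p q r → .{{NonZero (proj₂ q)}} → p ≤ᵣ q → q ≤ᵣ r → p ≤ᵣ r
≤ᵣ-trans (a , b) (c , d) (e , f) ad≤cb cf≤ed = *-cancelʳ-≤ (a * f) (e * b) d (begin
  a * f * d  ≡⟨ xy∙z≈xz∙y a f d ⟩
  a * d * f  ≤⟨ *-monoˡ-≤ f ad≤cb ⟩
  c * b * f  ≡⟨ xy∙z≈xz∙y c b f ⟩
  c * f * b  ≤⟨ *-monoˡ-≤ b cf≤ed ⟩
  e * d * b  ≡⟨ xy∙z≈xz∙y e d b ⟩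
  e * b * d  ∎)
  where open ≤-Reasoning

module _ (f : ℕ → ℕ × ℕ) (den≢0 : ∀ n → NonZero (proj₂ (f n))) where

  ≤ᵣ-antitone : (∀ n → f (suc n) ≤ᵣ f n) → ∀ {m n} → m ≤ n → f n ≤ᵣ f m
  ≤ᵣ-antitone step {m} m≤n = go (≤⇒≤′ m≤n)
    where
    go : ∀ {n} → m ≤′ n → f n ≤ᵣ f m
    go ≤′-refl            = ≤ᵣ-refl (f m)
    go (≤′-step {n} m≤′n) = ≤ᵣ-trans (f (suc n)) (f n) (f m) {{den≢0 n}} (step n) (go m≤′n)

  ≤ᵣ-monotone : (∀ n → f n ≤ᵣ f (suc n)) → ∀ {m n} → m ≤ n → f m ≤ᵣ f n
  ≤ᵣ-monotone step {m} m≤n = go (≤⇒≤′ m≤n)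
    where
    go : ∀ {n} → m ≤′ n → f m ≤ᵣ f n
    go ≤′-refl            = ≤ᵣ-refl (f m)
    go (≤′-step {n} m≤′n) = ≤ᵣ-trans (f m) (f n) (f (suc n)) {{den≢0 n}} (go m≤′n) (step n)

infixl 7 _·ᵣ_

_·ᵣ_ : ℕ × ℕ → ℕ × ℕ → ℕ × ℕ
(a , b) ·ᵣ (c , d) = a * c , b * d

≤ᵣ-·ᵣ : ∀ p w → proj₂ w ≤ proj₁ w → p ≤ᵣ p ·ᵣ w
≤ᵣ-·ᵣ (a , b) (c , d) d≤c = begin
  a * (b * d)  ≤⟨ *-monoʳ-≤ a (*-monoʳ-≤ b d≤c) ⟩
  a * (b * c)  ≡⟨ x∙yz≈xz∙y a b c ⟩
  a * c * b    ∎
  where open ≤-Reasoning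

^-distribʳ-* : ∀ m n o → (m * n) ^ o ≡ m ^ o * n ^ o
^-distribʳ-* m n zero    = refl
^-distribʳ-* m n (suc o) = begin
  m * n * (m * n) ^ o      ≡⟨ cong (m * n *_) (^-distribʳ-* m n o) ⟩
  m * n * (m ^ o * n ^ o)  ≡⟨ interchange m n (m ^ o) (n ^ o) ⟩
  m * m ^ o * (n * n ^ o)  ∎
  where open ≡-Reasoning

odd-suc : ∀ m → 1 + 2 * suc m ≡ 2 + (1 + 2 * m)
odd-suc m = cong suc (*-suc 2 m)

^-odd-suc : ∀ x m → x ^ (1 + 2 * suc m) ≡ x * (x * x ^ (1 + 2 * m))
^-odd-suc x m = cong (x ^_) (odd-suc m)

^-double : ∀ x n → x ^ (2 * n) ≡ x ^ n * x ^ n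
^-double x n = trans (cong (λ e → x ^ (n + e)) (+-identityʳ n)) (^-distribˡ-+-* x n n)

-- 6x³ times the first four terms of the binomial expansion of (1 + 1/x)^(2+i)
binomialLower : ℕ → ℕ → ℕ
binomialLower x i = 6 * x * x * x + 6 * (2 + i) * x * x + 3 * (2 + i) * (1 + i) * x + (2 + i) * (1 + i) * i

-- 6x³ (1 + j/x + j²/2x² + j³/3x³)
binomialUpper : ℕ → ℕ → ℕ
binomialUpper x j = 6 * x * x * x + 6 * j * x * x + 3 * j * j * x + 2 * j * j * j

binomialLower-≤ᵣ : ∀ x i → (binomialLower x i , 6 * x * x * x) ≤ᵣ (suc x ^ (2 + i) , x ^ (2 + i))
binomialLower-≤ᵣ x zero    = ≤-reflexive (base x)
  where
  base : ∀ x → (6 * x * x * x + 6 * 2 * x * x + 3 * 2 * 1 * x + 2 * 1 * 0) * (x * (x * 1))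
             ≡ suc x * (suc x * 1) * (6 * x * x * x)
  base = solve-∀
binomialLower-≤ᵣ x (suc i) = begin
  L (suc i) * (x * P)        ≡⟨ x∙yz≈yx∙z (L (suc i)) x P ⟩
  x * L (suc i) * P          ≤⟨ *-monoˡ-≤ P shift ⟩
  suc x * L i * P            ≡⟨ *-assoc (suc x) (L i) P ⟩
  suc x * (L i * P)          ≤⟨ *-monoʳ-≤ (suc x) (binomialLower-≤ᵣ x i) ⟩
  suc x * (suc x ^ (2 + i) * (6 * x * x * x))  ≡⟨ *-assoc (suc x) (suc x ^ (2 + i)) (6 * x * x * x) ⟨
  suc x ^ (3 + i) * (6 * x * x * x) ∎
  where
  open ≤-Reasoning
  L = binomialLower x
  P = x ^ (2 + i)
  shift : x * L (suc i) ≤ suc x * L i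
  shift = subst (x * L (suc i) ≤_) (sym (pascal x i)) (m≤m+n _ _)
    where
    pascal : ∀ x i → suc x * (6 * x * x * x + 6 * (2 + i) * x * x + 3 * (2 + i) * (1 + i) * x + (2 + i) * (1 + i) * i)
                   ≡ x * (6 * x * x * x + 6 * (3 + i) * x * x + 3 * (3 + i) * (2 + i) * x + (3 + i) * (2 + i) * (1 + i))
                     + (2 + i) * (1 + i) * i
    pascal = solve-∀

≤ᵣ-binomialUpper : ∀ x j → j ≤ x → (suc x ^ j , x ^ j) ≤ᵣ (binomialUpper x j , 6 * x * x * x)
≤ᵣ-binomialUpper x zero    _ = ≤-reflexive (base x)
  where
  base : ∀ x → 1 * (6 * x * x * x) ≡ (6 * x * x * x + 6 * 0 * x * x + 3 * 0 * 0 * x + 2 * 0 * 0 * 0) * 1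
  base = solve-∀
≤ᵣ-binomialUpper x (suc j) j<x = begin
  suc x * suc x ^ j * E    ≡⟨ *-assoc (suc x) (suc x ^ j) E ⟩
  suc x * (suc x ^ j * E)  ≤⟨ *-monoʳ-≤ (suc x) (≤ᵣ-binomialUpper x j (<⇒≤ j<x)) ⟩
  suc x * (U j * P)        ≡⟨ *-assoc (suc x) (U j) P ⟨
  suc x * U j * P          ≤⟨ *-monoˡ-≤ P shift ⟩
  x * U (suc j) * P        ≡⟨ xy∙z≈y∙xz x (U (suc j)) P ⟩
  U (suc j) * (x * P)      ∎
  where
  open ≤-Reasoning
  U = binomialUpper x
  E = 6 * x * x * x
  P = x ^ j
  shift : suc x * U j ≤ x * U (suc j)
  shift = +-cancelʳ-≤ (2 * j * j * j) _ _ (begin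
    suc x * U j + 2 * j * j * j  ≤⟨ +-monoʳ-≤ (suc x * U j) (≤-trans (*-monoʳ-≤ (2 * j * j) (<⇒≤ j<x)) (m≤m+n _ _)) ⟩
    suc x * U j + (2 * j * j * x + (3 * x * x + (j * j + 6 * j + 2) * x))  ≡⟨ expand x j ⟨
    x * U (suc j) + 2 * j * j * j  ∎)
    where
    expand : ∀ x j → x * (6 * x * x * x + 6 * (1 + j) * x * x + 3 * (1 + j) * (1 + j) * x + 2 * (1 + j) * (1 + j) * (1 + j))
                     + 2 * j * j * j
                   ≡ suc x * (6 * x * x * x + 6 * j * x * x + 3 * j * j * x + 2 * j * j * j)
                     + (2 * j * j * x + (3 * x * x + (j * j + 6 * j + 2) * x))
    expand = solve-∀

1+m*[2+m]≡[1+m]*[1+m] : ∀ m → suc (m * (2 + m)) ≡ suc m * suc m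
1+m*[2+m]≡[1+m]*[1+m] = solve-∀

T : ℕ → ℕ × ℕ
T m = suc m ^ (1 + 2 * m) , m ^ (1 + 2 * m)

T-step : ∀ t → T (2 + t) ≤ᵣ T (1 + t)
T-step t = begin
  (2 + m) ^ (1 + 2 * suc m) * m ^ e          ≡⟨ cong (_* m ^ e) (^-odd-suc (2 + m) m) ⟩
  (2 + m) * ((2 + m) * (2 + m) ^ e) * m ^ e  ≡⟨ regroup (2 + m) ((2 + m) ^ e) (m ^ e) ⟩
  (2 + m) * (2 + m) * (m ^ e * (2 + m) ^ e)  ≡⟨ cong ((2 + m) * (2 + m) *_) (^-distribʳ-* m (2 + m) e) ⟨
  (2 + m) * (2 + m) * D ^ e                  ≤⟨ binomial ⟩
  suc D ^ e * (suc m * suc m)                ≡⟨ cong (λ x → x ^ e * (suc m * suc m)) (1+m*[2+m]≡[1+m]*[1+m] m) ⟩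
  (suc m * suc m) ^ e * (suc m * suc m)      ≡⟨ cong (_* (suc m * suc m)) (^-distribʳ-* (suc m) (suc m) e) ⟩
  suc m ^ e * suc m ^ e * (suc m * suc m)    ≡⟨ regroup′ (suc m) (suc m ^ e) ⟩
  suc m ^ e * (suc m * (suc m * suc m ^ e))  ≡⟨ cong (suc m ^ e *_) (^-odd-suc (suc m) m) ⟨
  suc m ^ e * suc m ^ (1 + 2 * suc m)        ∎
  where
  open ≤-Reasoning
  m = suc t
  e = 1 + 2 * m
  D = m * (2 + m)
  polynomial : ((2 + m) * (2 + m) , suc m * suc m) ≤ᵣ (binomialLower D (1 + 2 * t) , 6 * D * D * D)
  polynomial = subst ((2 + m) * (2 + m) * (6 * D * D * D) ≤_) (sym (expand t)) (m≤m+n _ _)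
    where
    expand : ∀ t → let m = suc t ; D = m * (2 + m) ; i = 1 + 2 * t in
      (6 * D * D * D + 6 * (2 + i) * D * D + 3 * (2 + i) * (1 + i) * D + (2 + i) * (1 + i) * i) * (suc m * suc m)
      ≡ (2 + m) * (2 + m) * (6 * D * D * D) + (78 + t * (220 + t * (220 + t * (96 + t * (20 + t * 2)))))
    expand = solve-∀
  binomial : ((2 + m) * (2 + m) , suc m * suc m) ≤ᵣ (suc D ^ e , D ^ e)
  binomial = ≤ᵣ-trans ((2 + m) * (2 + m) , suc m * suc m) (binomialLower D (1 + 2 * t) , 6 * D * D * D)
                      (suc D ^ e , D ^ e) polynomial
    (subst (λ j → (binomialLower D (1 + 2 * t) , 6 * D * D * D) ≤ᵣ (suc D ^ j , D ^ j))
           (sym (odd-suc t)) (binomialLower-≤ᵣ D (1 + 2 * t)))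
  regroup : ∀ a w v → a * (a * w) * v ≡ a * a * (v * w)
  regroup = solve-∀
  regroup′ : ∀ s u → u * u * (s * s) ≡ u * (s * (s * u))
  regroup′ = solve-∀

X : ℕ → ℕ × ℕ
X m = let D = m * (2 + m) in suc m ^ (1 + 2 * m) * (D * D) , m ^ (1 + 2 * m) * (suc D * suc D)

X-step : ∀ t → X (1 + t) ≤ᵣ X (2 + t)
X-step t = begin
  S * (D * D) * (suc m ^ (1 + 2 * suc m) * (suc D′ * suc D′))
    ≡⟨ cong (λ x → S * (D * D) * (x * (suc D′ * suc D′))) (^-odd-suc (suc m) m) ⟩
  S * (D * D) * (suc m * (suc m * S) * (suc D′ * suc D′))  ≡⟨ regroup m S ⟩
  S * S * B * G                                            ≡⟨ cong (λ x → x * B * G) [1+D]^e≡S*S ⟨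
  suc D ^ e * B * G                                        ≤⟨ *-monoˡ-≤ G binomial ⟩
  A * D ^ e * G                                            ≡⟨ cong (λ x → A * x * G) (^-distribʳ-* m (2 + m) e) ⟩
  A * (M * W) * G                                          ≡⟨ regroup′ m M W ⟩
  (2 + m) * ((2 + m) * W) * (D′ * D′) * (M * (suc D * suc D))
    ≡⟨ cong (λ x → x * (D′ * D′) * (M * (suc D * suc D))) (^-odd-suc (2 + m) m) ⟨
  (2 + m) ^ (1 + 2 * suc m) * (D′ * D′) * (M * (suc D * suc D)) ∎
  where
  open ≤-Reasoning
  m = suc t
  e = 1 + 2 * m
  D = m * (2 + m)
  D′ = suc m * (3 + m)
  S = suc m ^ e
  M = m ^ e
  W = (2 + m) ^ e
  A = suc m * suc m * (suc m * suc m) * ((3 + m) * (3 + m))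
  B = m * m * ((2 + m) * (2 + m) * ((2 + m) * (2 + m)))
  G = (2 + m) * (2 + m) * (suc m * suc m)
  [1+D]^e≡S*S : suc D ^ e ≡ S * S
  [1+D]^e≡S*S = trans (cong (_^ e) (1+m*[2+m]≡[1+m]*[1+m] m)) (^-distribʳ-* (suc m) (suc m) e)
  e≤D : e ≤ D
  e≤D = subst (e ≤_) (sym (expand t)) (m≤m+n e _)
    where
    expand : ∀ t → suc t * (2 + suc t) ≡ (1 + 2 * suc t) + t * (2 + t)
    expand = solve-∀
  polynomial : (binomialUpper D e , 6 * D * D * D) ≤ᵣ (A , B)
  polynomial = subst (binomialUpper D e * B ≤_) (sym (expand t)) (m≤m+n _ _)
    where
    expand : ∀ t → let m = suc t ; D = m * (2 + m) ; e = 1 + 2 * m in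
      suc m * suc m * (suc m * suc m) * ((3 + m) * (3 + m)) * (6 * D * D * D)
      ≡ (6 * D * D * D + 6 * e * D * D + 3 * e * e * D + 2 * e * e * e) * (m * m * ((2 + m) * (2 + m) * ((2 + m) * (2 + m))))
        + m * m * ((2 + m) * (2 + m) * (2 + m)) * (159 + t * (381 + t * (297 + t * (87 + t * 8))))
    expand = solve-∀
  binomial : (suc D ^ e , D ^ e) ≤ᵣ (A , B)
  binomial = ≤ᵣ-trans (suc D ^ e , D ^ e) (binomialUpper D e , 6 * D * D * D) (A , B)
                      (≤ᵣ-binomialUpper D e e≤D) polynomial
  regroup : ∀ m S → let D = m * (2 + m) ; D′ = suc m * (3 + m) in
    S * (D * D) * (suc m * (suc m * S) * (suc D′ * suc D′))
    ≡ S * S * (m * m * ((2 + m) * (2 + m) * ((2 + m) * (2 + m)))) * ((2 + m) * (2 + m) * (suc m * suc m))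
  regroup = solve-∀
  regroup′ : ∀ m M W → let D = m * (2 + m) ; D′ = suc m * (3 + m) in
    suc m * suc m * (suc m * suc m) * ((3 + m) * (3 + m)) * (M * W) * ((2 + m) * (2 + m) * (suc m * suc m))
    ≡ (2 + m) * ((2 + m) * W) * (D′ * D′) * (M * (suc D * suc D))
  regroup′ = solve-∀

T-antitone : ∀ {m n} → m ≤ n → T (suc n) ≤ᵣ T (suc m)
T-antitone = ≤ᵣ-antitone (λ n → T (suc n)) (λ n → m^n≢0 (suc n) (1 + 2 * suc n)) T-step

X-monotone : ∀ {m n} → m ≤ n → X (suc m) ≤ᵣ X (suc n)
X-monotone = ≤ᵣ-monotone (λ n → X (suc n)) den≢0 X-step
  where
  den≢0 : ∀ n → NonZero (proj₂ (X (suc n)))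
  den≢0 n = m*n≢0 _ _ {{m^n≢0 (suc n) (1 + 2 * suc n)}}

Φ : ℕ → ℕ → ℕ × ℕ
Φ a b = (a + b) ! * (a + b) ! * a ^ (1 + 2 * a) * b ^ (1 + 2 * b)
      , (a + b) ^ (1 + 2 * (a + b)) * (a ! * a !) * (b ! * b !)

W : ℕ → ℕ → ℕ × ℕ
W a b = suc a * suc a * (suc b * suc b) * ((a + b) * (a + b))
      , a * a * (b * b) * (suc (a + b) * suc (a + b))

Ψ : ℕ → ℕ → ℕ × ℕ
Ψ a b = Φ a b ·ᵣ W a b

Φ-den≢0 : ∀ a b → NonZero (proj₂ (Φ (suc a) b))
Φ-den≢0 a b = m*n≢0 (n ^ (1 + 2 * n) * (suc a ! * suc a !)) (b ! * b !)
                {{m*n≢0 (n ^ (1 + 2 * n)) (suc a ! * suc a !) {{m^n≢0 n (1 + 2 * n)}} {{suc a !* suc a !≢0}}}}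
                {{b !* b !≢0}}
  where n = suc a + b

Ψ-den≢0 : ∀ a b → NonZero (proj₂ (Ψ (suc a) (suc b)))
Ψ-den≢0 a b = m*n≢0 (proj₂ (Φ (suc a) (suc b))) (proj₂ (W (suc a) (suc b))) {{Φ-den≢0 a (suc b)}}

Φ-comm : ∀ a b → Φ a b ≡ Φ b a
Φ-comm a b rewrite +-comm a b =
  cong₂ _,_ (xy∙z≈xz∙y ((b + a) ! * (b + a) !) (a ^ (1 + 2 * a)) (b ^ (1 + 2 * b)))
            (xy∙z≈xz∙y ((b + a) ^ (1 + 2 * (b + a))) (a ! * a !) (b ! * b !))

W-comm : ∀ a b → W a b ≡ W b a
W-comm a b rewrite +-comm a b =
  cong₂ _,_ (cong (_* ((b + a) * (b + a))) (*-comm (suc a * suc a) (suc b * suc b)))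
            (cong (_* (suc (b + a) * suc (b + a))) (*-comm (a * a) (b * b)))

Ψ-comm : ∀ a b → Ψ a b ≡ Ψ b a
Ψ-comm a b = cong₂ _·ᵣ_ (Φ-comm a b) (W-comm a b)

W-≥1 : ∀ a b → proj₂ (W a b) ≤ proj₁ (W a b)
W-≥1 a b = subst₂ _≤_ (square-* a b (suc (a + b))) (square-* (suc a) (suc b) (a + b))
                  (*-mono-≤ ab[1+a+b]≤[1+a][1+b][a+b] ab[1+a+b]≤[1+a][1+b][a+b])
  where
  square-* : ∀ x y z → x * y * z * (x * y * z) ≡ x * x * (y * y) * (z * z)
  square-* x y z = trans (interchange (x * y) z (x * y) z) (cong (_* (z * z)) (interchange x y x y))
  ab[1+a+b]≤[1+a][1+b][a+b] : a * b * suc (a + b) ≤ suc a * suc b * (a + b)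
  ab[1+a+b]≤[1+a][1+b][a+b] = subst (a * b * suc (a + b) ≤_) (sym (expand a b)) (m≤m+n _ _)
    where
    expand : ∀ a b → suc a * suc b * (a + b) ≡ a * b * suc (a + b) + (a * a + a * b + b * b + a + b)
    expand = solve-∀

Φ-step : ∀ a b → Φ (1 + a) b ≤ᵣ Φ (2 + a) b
Φ-step a b = begin
  n ! * n ! * A * B * (suc n ^ (1 + 2 * suc n) * (α ! * α !) * (b ! * b !))
    ≡⟨ cong (λ x → n ! * n ! * A * B * (x * (α ! * α !) * (b ! * b !))) (^-odd-suc (suc n) n) ⟩
  n ! * n ! * A * B * (suc n * (suc n * U) * (α ! * α !) * (b ! * b !))
    ≡⟨ regroup (n !) (a′ !) (b !) a′ b U A B ⟩
  F * (U * A)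
    ≤⟨ *-monoʳ-≤ F (T-antitone (m≤m+n a b)) ⟩
  F * (V * N)
    ≡⟨ regroup′ (n !) (a′ !) (b !) a′ b V N B ⟩
  suc n ! * suc n ! * (α * (α * V)) * B * (N * (a′ ! * a′ !) * (b ! * b !))
    ≡⟨ cong (λ x → suc n ! * suc n ! * x * B * (N * (a′ ! * a′ !) * (b ! * b !))) (^-odd-suc α a′) ⟨
  suc n ! * suc n ! * α ^ (1 + 2 * α) * B * (N * (a′ ! * a′ !) * (b ! * b !)) ∎
  where
  open ≤-Reasoning
  a′ = suc a
  α = suc a′
  n = a′ + b
  A = a′ ^ (1 + 2 * a′)
  B = b ^ (1 + 2 * b)
  N = n ^ (1 + 2 * n)
  U = suc n ^ (1 + 2 * n)
  V = α ^ (1 + 2 * a′)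
  F = n ! * n ! * B * (suc n * suc n) * (α * α) * (a′ ! * a′ !) * (b ! * b !)
  regroup : ∀ nf af bf a b U A B → let n = a + b ; α = suc a in
    nf * nf * A * B * (suc n * (suc n * U) * (α * af * (α * af)) * (bf * bf))
    ≡ nf * nf * B * (suc n * suc n) * (α * α) * (af * af) * (bf * bf) * (U * A)
  regroup = solve-∀
  regroup′ : ∀ nf af bf a b V N B → let n = a + b ; α = suc a in
    nf * nf * B * (suc n * suc n) * (α * α) * (af * af) * (bf * bf) * (V * N)
    ≡ suc n * nf * (suc n * nf) * (α * (α * V)) * B * (N * (af * af) * (bf * bf))
  regroup′ = solve-∀

Ψ-step : ∀ a b → Ψ (2 + a) b ≤ᵣ Ψ (1 + a) b
Ψ-step a b = begin
  suc n ! * suc n ! * α ^ (1 + 2 * α) * B * Wα₁ * (N * (a′ ! * a′ !) * (b ! * b !) * Wa₂)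
    ≡⟨ cong (λ x → suc n ! * suc n ! * x * B * Wα₁ * (N * (a′ ! * a′ !) * (b ! * b !) * Wa₂)) (^-odd-suc α a′) ⟩
  suc n ! * suc n ! * (α * (α * V)) * B * Wα₁ * (N * (a′ ! * a′ !) * (b ! * b !) * Wa₂)
    ≡⟨ regroup (n !) (a′ !) (b !) a′ b V N B ⟩
  G * (proj₁ (X a′) * proj₂ (X n))
    ≤⟨ *-monoʳ-≤ G (X-monotone (m≤m+n a b)) ⟩
  G * (proj₁ (X n) * proj₂ (X a′))
    ≡⟨ regroup′ (n !) (a′ !) (b !) a′ b U A B ⟩
  n ! * n ! * A * B * Wa₁ * (suc n * (suc n * U) * (α ! * α !) * (b ! * b !) * Wα₂)
    ≡⟨ cong (λ x → n ! * n ! * A * B * Wa₁ * (x * (α ! * α !) * (b ! * b !) * Wα₂)) (^-odd-suc (suc n) n) ⟨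
  n ! * n ! * A * B * Wa₁ * (suc n ^ (1 + 2 * suc n) * (α ! * α !) * (b ! * b !) * Wα₂) ∎
  where
  open ≤-Reasoning
  a′ = suc a
  α = suc a′
  n = a′ + b
  A = a′ ^ (1 + 2 * a′)
  B = b ^ (1 + 2 * b)
  N = n ^ (1 + 2 * n)
  U = suc n ^ (1 + 2 * n)
  V = α ^ (1 + 2 * a′)
  Wa₁ = proj₁ (W a′ b)
  Wa₂ = proj₂ (W a′ b)
  Wα₁ = proj₁ (W α b)
  Wα₂ = proj₂ (W α b)
  G = n ! * n ! * B * (α * α) * (suc b * suc b) * (a′ ! * a′ !) * (b ! * b !) * (b * b) * (suc n * suc n)
  regroup : ∀ nf af bf a b V N B → let n = a + b ; α = suc a ; Da = a * (2 + a) ; Dn = n * (2 + n) in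
    suc n * nf * (suc n * nf) * (α * (α * V)) * B * (suc α * suc α * (suc b * suc b) * (suc n * suc n))
      * (N * (af * af) * (bf * bf) * (a * a * (b * b) * (suc n * suc n)))
    ≡ nf * nf * B * (α * α) * (suc b * suc b) * (af * af) * (bf * bf) * (b * b) * (suc n * suc n)
      * (V * (Da * Da) * (N * (suc Dn * suc Dn)))
  regroup = solve-∀
  regroup′ : ∀ nf af bf a b U A B → let n = a + b ; α = suc a ; Da = a * (2 + a) ; Dn = n * (2 + n) in
    nf * nf * B * (α * α) * (suc b * suc b) * (af * af) * (bf * bf) * (b * b) * (suc n * suc n)
      * (U * (Dn * Dn) * (A * (suc Da * suc Da)))
    ≡ nf * nf * A * B * (α * α * (suc b * suc b) * (n * n))
      * (suc n * (suc n * U) * (α * af * (α * af)) * (bf * bf) * (α * α * (b * b) * (suc (suc n) * suc (suc n))))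
  regroup′ = solve-∀

Φ-monoˡ : ∀ b {a a′} → a ≤ a′ → Φ (suc a) b ≤ᵣ Φ (suc a′) b
Φ-monoˡ b = ≤ᵣ-monotone (λ a → Φ (suc a) b) (λ a → Φ-den≢0 a b) (λ a → Φ-step a b)

Φ-monoʳ : ∀ a {b b′} → b ≤ b′ → Φ a (suc b) ≤ᵣ Φ a (suc b′)
Φ-monoʳ a {b} {b′} b≤b′ = subst₂ _≤ᵣ_ (Φ-comm (suc b) a) (Φ-comm (suc b′) a) (Φ-monoˡ a b≤b′)

Ψ-antitoneˡ : ∀ b {a a′} → a ≤ a′ → Ψ (suc a′) (suc b) ≤ᵣ Ψ (suc a) (suc b)
Ψ-antitoneˡ b = ≤ᵣ-antitone (λ a → Ψ (suc a) (suc b)) (λ a → Ψ-den≢0 a b) (λ a → Ψ-step a (suc b))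

Ψ-antitoneʳ : ∀ a {b b′} → b ≤ b′ → Ψ (suc a) (suc b′) ≤ᵣ Ψ (suc a) (suc b)
Ψ-antitoneʳ a {b} {b′} b≤b′ = subst₂ _≤ᵣ_ (Ψ-comm (suc b′) (suc a)) (Ψ-comm (suc b) (suc a)) (Ψ-antitoneˡ a b≤b′)

Φ≤ᵣΨ : ∀ a b → Φ a b ≤ᵣ Ψ a b
Φ≤ᵣΨ a b = ≤ᵣ-·ᵣ (Φ a b) (W a b) (W-≥1 a b)

Φ≤ᵣΨ-uniform : ∀ k M A B → .{{NonZero k}} → .{{NonZero M}} → .{{NonZero A}} → .{{NonZero B}} →
               Φ k M ≤ᵣ Ψ A B
Φ≤ᵣΨ-uniform k@(suc k₀) M@(suc M₀) A@(suc A₀) B@(suc B₀) =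
  ≤ᵣ-trans (Φ k M) (Φ a M) (Ψ A B) {{Φ-den≢0 (A₀ + k₀) M}} (Φ-monoˡ M (m≤n+m k₀ A₀)) (
  ≤ᵣ-trans (Φ a M) (Φ a b) (Ψ A B) {{Φ-den≢0 (A₀ + k₀) b}} (Φ-monoʳ a (m≤n+m M₀ B₀)) (
  ≤ᵣ-trans (Φ a b) (Ψ a b) (Ψ A B) {{Ψ-den≢0 (A₀ + k₀) (B₀ + M₀)}} (Φ≤ᵣΨ a b) (
  ≤ᵣ-trans (Ψ a b) (Ψ A b) (Ψ A B) {{Ψ-den≢0 A₀ (B₀ + M₀)}} (Ψ-antitoneˡ (B₀ + M₀) (m≤m+n A₀ k₀))
                                                             (Ψ-antitoneʳ A₀ (m≤m+n B₀ M₀)))))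
  where
  a = suc (A₀ + k₀)
  b = suc (B₀ + M₀)

binomial-factorials : ∀ k M → ((k + M) C k) * k ! * M ! ≡ (k + M) !
binomial-factorials k M = begin
  (n C k) * k ! * M !                          ≡⟨ *-assoc (n C k) (k !) (M !) ⟩
  (n C k) * (k ! * M !)                        ≡⟨ cong₂ (λ c j → c * (k ! * j !)) (nCk≡n!/k![n-k]! k≤n) (sym (m+n∸m≡n k M)) ⟩
  n ! / (k ! * (n ∸ k) !) * (k ! * (n ∸ k) !)  ≡⟨ m/n*n≡m (k![n∸k]!∣n! k≤n) ⟩
  n !                                          ∎
  where
  open ≡-Reasoning
  n = k + M
  k≤n = m≤m+n k M
  instance _ = k !* (n ∸ k) !≢0

binomial-bound : ∀ k M p q → .{{NonZero k}} → Φ k M ≤ᵣ (p , q) → (k + M) * (k + M) * p < k * M * q →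
                 (((k + M) C k) * k ^ k * M ^ M) ^ 2 * (k + M) < (k + M) ^ (2 * (k + M))
binomial-bound k M p q Φ≤p/q N²p<kMq = *-cancelʳ-< (k * M * q) (c ^ 2 * N) (N ^ (2 * N)) (begin-strict
  c ^ 2 * N * (k * M * q)      ≡⟨ regroup c N (k * M * q) ⟩
  N * (c * c * (k * M * q))    ≤⟨ *-monoʳ-≤ N factorials-cancelled ⟩
  N * (p * (N * N ^ (2 * N)))  ≡⟨ regroup′ N p (N ^ (2 * N)) ⟩
  N * N * p * N ^ (2 * N)      <⟨ *-monoˡ-< (N ^ (2 * N)) {{m^n≢0 N (2 * N) {{N≢0}}}} N²p<kMq ⟩
  k * M * q * N ^ (2 * N)      ≡⟨ *-comm (k * M * q) (N ^ (2 * N)) ⟩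
  N ^ (2 * N) * (k * M * q)    ∎)
  where
  open ≤-Reasoning
  N = k + M
  N≢0 : NonZero N
  N≢0 = >-nonZero (<-≤-trans (>-nonZero⁻¹ k) (m≤m+n k M))
  c = (N C k) * k ^ k * M ^ M
  f = k ! * M !
  factorials-cancelled : c * c * (k * M * q) ≤ p * N ^ (1 + 2 * N)
  factorials-cancelled = *-cancelˡ-≤ (f * f) {{m*n≢0 f f {{k !* M !≢0}} {{k !* M !≢0}}}} (begin
    f * f * (c * c * (k * M * q))
      ≡⟨ expandˡ (N C k) (k !) (M !) k M (k ^ k) (M ^ M) q ⟩
    (N C k) * k ! * M ! * ((N C k) * k ! * M !) * (k * (k ^ k * k ^ k)) * (M * (M ^ M * M ^ M)) * q
      ≡⟨ cong₂ (λ x y → x * x * (k * y) * (M * (M ^ M * M ^ M)) * q) (binomial-factorials k M) (sym (^-double k k)) ⟩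
    N ! * N ! * k ^ (1 + 2 * k) * (M * (M ^ M * M ^ M)) * q
      ≡⟨ cong (λ y → N ! * N ! * k ^ (1 + 2 * k) * (M * y) * q) (sym (^-double M M)) ⟩
    N ! * N ! * k ^ (1 + 2 * k) * M ^ (1 + 2 * M) * q
      ≤⟨ Φ≤p/q ⟩
    p * (N ^ (1 + 2 * N) * (k ! * k !) * (M ! * M !))
      ≡⟨ expandʳ p (N ^ (1 + 2 * N)) (k !) (M !) ⟩
    f * f * (p * N ^ (1 + 2 * N)) ∎)
    where
    expandˡ : ∀ C kf mf k M K L q → kf * mf * (kf * mf) * (C * K * L * (C * K * L) * (k * M * q))
                                    ≡ C * kf * mf * (C * kf * mf) * (k * (K * K)) * (M * (L * L)) * q
    expandˡ = solve-∀
    expandʳ : ∀ p X kf mf → p * (X * (kf * kf) * (mf * mf)) ≡ kf * mf * (kf * mf) * (p * X)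
    expandʳ = solve-∀
  regroup : ∀ c N x → c * (c * 1) * N * x ≡ N * (c * c * x)
  regroup = solve-∀
  regroup′ : ∀ N p y → N * (p * (N * y)) ≡ N * N * p * y
  regroup′ = solve-∀

BinomBound-from-Φ : ∀ k r p q → .{{NonZero k}} → Φ k (4 * k + r) ≤ᵣ (p , q) →
                    (5 * k + r) * (5 * k + r) * p < k * (4 * k + r) * q → BinomBound k r
BinomBound-from-Φ k r p q Φ≤p/q N²p<kMq =
  subst (λ N → ((N C k) * k ^ k * M ^ M) ^ 2 * N < N ^ (2 * N)) (k+M≡N k r)
        (binomial-bound k M p q Φ≤p/q (subst (λ N → N * N * p < k * M * q) (sym (k+M≡N k r)) N²p<kMq))
  where
  M = 4 * k + r
  k+M≡N : ∀ k r → k + (4 * k + r) ≡ 5 * k + r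
  k+M≡N = solve-∀

quadratic-< : ∀ {a₂ a₁ a₀ b₂ b₁} K {k} → .{{NonZero K}} → K ≤ k → a₂ ≤ b₂ →
              a₂ * K * K + a₁ * K + a₀ < b₂ * K * K + b₁ * K →
              a₂ * k * k + a₁ * k + a₀ < b₂ * k * k + b₁ * k
quadratic-< {a₂} {a₁} {a₀} {b₂} {b₁} K K≤k a₂≤b₂ p<q =
  subst (λ k → a₂ * k * k + a₁ * k + a₀ < b₂ * k * k + b₁ * k) (m+[n∸m]≡n K≤k) (shifted _)
  where
  open ≤-Reasoning
  expand₁ : ∀ a₂ a₁ a₀ K t → K * (a₂ * (K + t) * (K + t) + a₁ * (K + t) + a₀) + t * a₀
                              ≡ (K + t) * (K * a₂ * (K + t) + K * a₁ + a₀)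
  expand₁ = solve-∀
  expand₂ : ∀ b₂ b₁ K t → (K + t) * (K * b₂ * (K + t) + K * b₁) ≡ K * (b₂ * (K + t) * (K + t) + b₁ * (K + t))
  expand₂ = solve-∀
  expand₃ : ∀ a₂ a₁ a₀ K t → K * a₂ * (K + t) + K * a₁ + a₀ ≡ a₂ * K * K + a₁ * K + a₀ + K * a₂ * t
  expand₃ = solve-∀
  expand₄ : ∀ b₂ b₁ K t → b₂ * K * K + b₁ * K + K * b₂ * t ≡ K * b₂ * (K + t) + K * b₁
  expand₄ = solve-∀
  shifted : ∀ t → let k = K + t in a₂ * k * k + a₁ * k + a₀ < b₂ * k * k + b₁ * k
  shifted t = *-cancelˡ-< K _ _ (begin-strict
    K * (a₂ * k * k + a₁ * k + a₀)             ≤⟨ m≤m+n _ (t * a₀) ⟩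
    K * (a₂ * k * k + a₁ * k + a₀) + t * a₀    ≡⟨ expand₁ a₂ a₁ a₀ K t ⟩
    k * (K * a₂ * k + K * a₁ + a₀)             <⟨ *-monoʳ-< k {{k≢0}} linear ⟩
    k * (K * b₂ * k + K * b₁)                  ≡⟨ expand₂ b₂ b₁ K t ⟩
    K * (b₂ * k * k + b₁ * k)                  ∎)
    where
    k = K + t
    k≢0 : NonZero k
    k≢0 = >-nonZero (<-≤-trans (>-nonZero⁻¹ K) (m≤m+n K t))
    linear : K * a₂ * k + K * a₁ + a₀ < K * b₂ * k + K * b₁
    linear = begin-strict
      K * a₂ * k + K * a₁ + a₀               ≡⟨ expand₃ a₂ a₁ a₀ K t ⟩
      a₂ * K * K + a₁ * K + a₀ + K * a₂ * t  <⟨ +-mono-<-≤ p<q (*-monoˡ-≤ t (*-monoʳ-≤ K a₂≤b₂)) ⟩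
      b₂ * K * K + b₁ * K + K * b₂ * t       ≡⟨ expand₄ b₂ b₁ K t ⟩
      K * b₂ * k + K * b₁                    ∎

-- Ψ 3000 3000 ≈ 0.159301 lies just below 4/25, while Φ and Ψ both tend to 1/2π ≈ 0.159155
ψ : ℕ × ℕ
ψ = Ψ 3000 3000

ψ-margin : ∀ k r → 140 ≤ k → r ≤ 4 → (5 * k + r) * (5 * k + r) * proj₁ ψ < k * (4 * k + r) * proj₂ ψ
ψ-margin k r 140≤k r≤4 = subst₂ _<_ (sym (expandˡ k r p)) (sym (expandʳ k r q)) quadratic
  where
  p = proj₁ ψ
  q = proj₂ ψ
  at-140 : ∀ {r} → r < 5 → 25 * p * 140 * 140 + 10 * r * p * 140 + r * r * p < 4 * q * 140 * 140 + r * q * 140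
  at-140 = from-yes (allUpTo? (λ r → 25 * p * 140 * 140 + 10 * r * p * 140 + r * r * p <? 4 * q * 140 * 140 + r * q * 140) 5)
  -- Left to unification, the coefficients would make Agda evaluate ψ over and over.
  quadratic : 25 * p * k * k + 10 * r * p * k + r * r * p < 4 * q * k * k + r * q * k
  quadratic = quadratic-< {25 * p} {10 * r * p} {r * r * p} {4 * q} {r * q} 140 140≤k
                          (from-yes (25 * p ≤? 4 * q)) (at-140 (s≤s r≤4))
  expandˡ : ∀ k r p → (5 * k + r) * (5 * k + r) * p ≡ 25 * p * k * k + 10 * r * p * k + r * r * p
  expandˡ = solve-∀
  expandʳ : ∀ k r q → k * (4 * k + r) * q ≡ 4 * q * k * k + r * q * k
  expandʳ = solve-∀

BinomBound-large : ∀ k r → 140 ≤ k → r ≤ 4 → BinomBound k r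
BinomBound-large k@(suc _) r 140≤k r≤4 =
  BinomBound-from-Φ k r (proj₁ ψ) (proj₂ ψ) (Φ≤ᵣΨ-uniform k (4 * k + r) 3000 3000) (ψ-margin k r 140≤k r≤4)

BinomBound? : ∀ k r → Dec (BinomBound k r)
BinomBound? k r = _ <? _

BinomBound-small : ∀ k r → 80 ≤ k → k < 140 → r ≤ 4 → BinomBound k r
BinomBound-small k r 80≤k k<140 r≤4 =
  subst (λ k → BinomBound k r) (m+[n∸m]≡n 80≤k) (table (∸-monoˡ-< k<140 80≤k) (s≤s r≤4))
  where
  table : ∀ {i} → i < 60 → ∀ {r} → r < 5 → BinomBound (80 + i) r
  table = from-yes (allUpTo? (λ i → allUpTo? (BinomBound? (80 + i)) 5) 60)

lemma2p2 : (k r : ℕ) → 80 ≤ k → r ≤ 4 → BinomBound k r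
lemma2p2 k r 80≤k r≤4 with k <? 140
... | yes k<140 = BinomBound-small k r 80≤k k<140 r≤4
... | no  k≮140 = BinomBound-large k r (≮⇒≥ k≮140) r≤4
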